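{- Let $q$ be a prime power, let $d+1$ be a divisor of $q-1$, and let $f:\mathbb{F}_q\to\mathbb{F}_q$ be $(d+1)$-divisible and differentially $d$-uniform. Then $f$ is almost-$(d+1)$-to-1.
   Context: For a divisor $k$ of $q-1$, a map $f$ is $k$-divisible if $f(x)=f'(x^k)$ for some map $f':\mathbb{F}_q\to\mathbb{F}_q$. $f$ is (differentially) $d$-uniform if $d=\max_{a\neq 0,\, b\in\mathbb{F}_q}|\{x\in\mathbb{F}_q: f(x+a)-f(x)=b\}|$. A map $f$ is almost-$k$-to-1 if there is a unique element of $\mathrm{Im}(f)$ with exactly one preimage and every other element of $\mathrm{Im}(f)$ has exactly $k$ preimages. -}

module Defs where

open import Level using (0ℓ)
open import Data.Nat using (ℕ; zero; suc; _^_; _≤_; _∸_)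
open import Data.Nat.Primality using (Prime)
open import Data.Fin using (Fin)
open import Data.List using (List; length; filter; allFin)
open import Data.Product using (∃; ∃-syntax; _×_; Σ-syntax)
open import Relation.Nullary using (¬_)
open import Relation.Unary using (Pred; Decidable)
open import Relation.Binary.PropositionalEquality using (_≡_; _≢_)
open import Relation.Binary.Definitions using (DecidableEquality)
open import Function.Bundles using (_↔_; Inverse)
open import Algebra.Structures using (IsCommutativeRing)

IsPrimePower : ℕ → Set
IsPrimePower q = ∃[ p ] ∃[ k ] (Prime p × 1 ≤ k × q ≡ p ^ k)

record FiniteField (q : ℕ) : Set₁ where
  infixl 6 _+_
  infixl 7 _*_
  field
    Carrier : Set
    _+_ _*_ : Carrier → Carrier → Carrier
    -_      : Carrier → Carrier
    0# 1#   : Carrier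
    isCommutativeRing : IsCommutativeRing _≡_ _+_ _*_ -_ 0# 1#
    1≢0     : 1# ≢ 0#
    inverse : ∀ x → x ≢ 0# → ∃[ y ] (x * y ≡ 1#)
    _≟_     : DecidableEquality Carrier
    enum    : Fin q ↔ Carrier

  _-_ : Carrier → Carrier → Carrier
  a - b = a + (- b)

  pow : Carrier → ℕ → Carrier
  pow x zero = 1#
  pow x (suc n) = x * pow x n

  count : (P : Pred Carrier 0ℓ) → Decidable P → ℕ
  count P P? = length (filter {P = λ i → P (Inverse.to enum i)} (λ i → P? (Inverse.to enum i)) (allFin q))

  Divisible : ℕ → (Carrier → Carrier) → Set
  Divisible k f = Σ[ f' ∈ (Carrier → Carrier) ] (∀ (x : Carrier) → f x ≡ f' (pow x k))

  δ : (Carrier → Carrier) → Carrier → Carrier → ℕ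
  δ f a b = count (λ x → f (x + a) - f x ≡ b) (λ x → (f (x + a) - f x) ≟ b)

  DiffUniform : ℕ → (Carrier → Carrier) → Set
  DiffUniform d f =
    (∀ a b → a ≢ 0# → δ f a b ≤ d) × (∃[ a ] ∃[ b ] (a ≢ 0# × δ f a b ≡ d))

  preimages : (Carrier → Carrier) → Carrier → ℕ
  preimages f y = count (λ x → f x ≡ y) (λ x → f x ≟ y)

  InImage : (Carrier → Carrier) → Carrier → Set
  InImage f y = ∃[ x ] (f x ≡ y)

  AlmostKTo1 : ℕ → (Carrier → Carrier) → Set
  AlmostKTo1 k f =
    Σ[ y₀ ∈ Carrier ]
      ( InImage f y₀
      × preimages f y₀ ≡ 1
      × (∀ y → InImage f y → preimages f y ≡ 1 → y ≡ y₀)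
      × (∀ y → InImage f y → y ≢ y₀ → preimages f y ≡ k))

-- Write k = d + 1 and μ k for the k-th roots of unity. Since k divides q - 1, |μ k| = k: the map
-- x ↦ (x ^ k, x / ρ(x ^ k)), with ρ(c) a fixed k-th root of c, embeds the q - 1 nonzero elements
-- into μ ((q - 1) / k) × μ k, and |μ n| ≤ n by the root bound for monic polynomials.
-- If f u = f v but u ^ k ≠ v ^ k, then for a = u - v the point v and the k - 1 points
-- x = a / (ζ - 1), ζ ∈ μ k ∖ {1}, are distinct zeros of f (x + a) - f x: f factors through
-- x ↦ x ^ k, and x + a = ζ x gives (x + a) ^ k = x ^ k. This contradicts δ ≤ d. Hence the fibre
-- of f u is the coset u · μ k, of size k, for u ≠ 0, and the fibre of f 0 is {0}.
module Submission where

open import Defs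
open import Data.Nat as ℕ using (ℕ; suc; _∸_; zero; _≤_; _<_; z≤n; s≤s; NonZero)
open import Data.Nat.Divisibility using (_∣_; divides)
import Data.Nat.Properties as ℕₚ
open import Level using (0ℓ)
open import Data.Fin using (Fin)
open import Data.Vec using (Vec; []; _∷_; replicate)
open import Data.List
  using (List; []; _∷_; [_]; length; map; filter; foldr; allFin; cartesianProduct; _++_)
open import Data.List.Properties using (length-map; length-++; filter-notAll; length-tabulate)
open import Data.List.Membership.Propositional using (_∈_)
open import Data.List.Membership.Propositional.Properties
  using ( ∈-filter⁺; ∈-filter⁻; ∈-map⁺; ∈-map⁻; ∈-map∘filter⁺; ∈-map∘filter⁻; ∈-allFin
        ; ∈-cartesianProduct⁺)
open import Data.List.Membership.Propositional.Properties.WithK using (unique∧set⇒bag)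
open import Data.List.Relation.Binary.Subset.Propositional using (_⊆_)
open import Data.List.Relation.Binary.BagAndSetEquality using (∼bag⇒↭)
open import Data.List.Relation.Binary.Permutation.Propositional using (_↭_; ↭⇒↭ₛ)
import Data.List.Relation.Binary.Permutation.Setoid.Properties as Permutation
open import Data.List.Relation.Unary.Any as Any using (here; there; any?; satisfied)
open import Data.List.Relation.Unary.All as All using (All; []; _∷_)
import Data.List.Relation.Unary.All.Properties as AllP
open import Data.List.Relation.Unary.Unique.Propositional using (Unique; []; _∷_)
import Data.List.Relation.Unary.Unique.Propositional.Properties as Unique
open import Data.Product using (_×_; _,_; proj₁; proj₂)
open import Data.Product.Properties using (≡-dec)
open import Function using (_∘_)
open import Function.Bundles using (Inverse; Injection; mk⇔)
open import Function.Properties.Inverse using (↔⇒↣)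
open import Relation.Nullary using (Dec; yes; no; ¬_; ¬?)
open import Relation.Nullary.Negation using (contradiction)
open import Relation.Unary using (Pred; Decidable)
open import Relation.Binary.Definitions using (DecidableEquality)
open import Relation.Binary.PropositionalEquality
  using (_≡_; _≢_; refl; sym; trans; cong; cong₂; subst; setoid; module ≡-Reasoning)
open import Algebra.Bundles using (CommutativeRing)
import Algebra.Properties.Group as GroupProperties
import Algebra.Properties.CommutativeSemigroup as CommutativeSemigroupProperties
import Algebra.Properties.CommutativeSemiring.Exp as Exp
open import Tactic.RingSolver using (solve-∀)
open import Tactic.RingSolver.Core.AlmostCommutativeRing using (AlmostCommutativeRing; fromCommutativeRing)
open import Data.Maybe using (nothing)
Unique-length-≤ : {A : Set} → DecidableEquality A →
                  {xs ys : List A} → Unique xs → xs ⊆ ys → length xs ≤ length ys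
Unique-length-≤ _≟_ {[]} _ _ = z≤n
Unique-length-≤ _≟_ {x ∷ xs} {ys} (x∉xs ∷ xs!) xs⊆ys =
  ℕₚ.≤-trans (s≤s (Unique-length-≤ _≟_ xs! xs⊆ys∖x)) (filter-notAll x≢? ys x∈ys)
  where
  x≢? = ¬? ∘ (x ≟_)

  xs⊆ys∖x : xs ⊆ filter x≢? ys
  xs⊆ys∖x z∈xs = ∈-filter⁺ x≢? (xs⊆ys (there z∈xs)) (All.lookup x∉xs z∈xs)

  x∈ys : Any.Any (λ y → ¬ (x ≢ y)) ys
  x∈ys = Any.map (λ x≡y x≢y → x≢y x≡y) (xs⊆ys (here refl))

length-cartesianProduct : {A B : Set} (xs : List A) (ys : List B) →
                          length (cartesianProduct xs ys) ≡ length xs ℕ.* length ys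
length-cartesianProduct [] ys = refl
length-cartesianProduct (x ∷ xs) ys = begin
  length (map (x ,_) ys ++ cartesianProduct xs ys)
    ≡⟨ length-++ (map (x ,_) ys) ⟩
  length (map (x ,_) ys) ℕ.+ length (cartesianProduct xs ys)
    ≡⟨ cong₂ ℕ._+_ (length-map (x ,_) ys) (length-cartesianProduct xs ys) ⟩
  length ys ℕ.+ length xs ℕ.* length ys ∎
  where open ≡-Reasoning

-- Phrased at the point y + r, and with 1# abstracted to o, because the solver has no zero test
-- for coefficients and so can neither cancel - r + r nor recognise 1# as the unit.
module HornerIdentities {q : ℕ} (F : FiniteField q) where
  private
    ring : AlmostCommutativeRing 0ℓ 0ℓ
    ring = fromCommutativeRing (record { isCommutativeRing = FiniteField.isCommutativeRing F })
                               (λ _ → nothing)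
  open AlmostCommutativeRing ring

  horner-base : ∀ y r o c → (y + r) * o + c ≈ y * o + (r * o + c)
  horner-base = solve-∀ ring

  horner-step : ∀ y r D e c → (y + r) * (y * D + e) + c ≈ y * ((y + r) * D + e) + (r * e + c)
  horner-step = solve-∀ ring

module FieldArithmetic {q : ℕ} (F : FiniteField q) where
  open FiniteField F

  commutativeRing : CommutativeRing 0ℓ 0ℓ
  commutativeRing = record { isCommutativeRing = isCommutativeRing }

  open CommutativeRing commutativeRing public
    using ( +-comm; +-identityʳ; *-comm; *-assoc; *-identityˡ; *-identityʳ; zeroˡ; zeroʳ
          ; distribʳ; +-group; *-isCommutativeMonoid; *-commutativeSemigroup; commutativeSemiring)
  open GroupProperties +-group using (//-rightDividesˡ; x∙y⁻¹≈ε⇒x≈y; x≈y⇒x∙y⁻¹≈ε)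
  open CommutativeSemigroupProperties *-commutativeSemigroup using (x∙yz≈y∙xz)
  open Exp commutativeSemiring using (_^_; ^-assocʳ; ^-distrib-*)
  open ≡-Reasoning

  x-y≡0⇒x≡y : ∀ {x y} → x - y ≡ 0# → x ≡ y
  x-y≡0⇒x≡y = x∙y⁻¹≈ε⇒x≈y _ _

  x≡y⇒x-y≡0 : ∀ {x y} → x ≡ y → x - y ≡ 0#
  x≡y⇒x-y≡0 = x≈y⇒x∙y⁻¹≈ε

  x-y+y≡x : ∀ x y → (x - y) + y ≡ x
  x-y+y≡x x y = //-rightDividesˡ y x

  -- 0 ⁻¹ = 0 is a junk value.
  _⁻¹ : Carrier → Carrier
  x ⁻¹ with x ≟ 0#
  ... | yes _ = 0#
  ... | no x≢0 = proj₁ (inverse x x≢0)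

  ⁻¹-inverseʳ : ∀ {x} → x ≢ 0# → x * x ⁻¹ ≡ 1#
  ⁻¹-inverseʳ {x} x≢0 with x ≟ 0#
  ... | yes x≡0 = contradiction x≡0 x≢0
  ... | no x≢0′ = proj₂ (inverse x x≢0′)

  ⁻¹-cancelˡ : ∀ {x} → x ≢ 0# → ∀ y → x ⁻¹ * (x * y) ≡ y
  ⁻¹-cancelˡ {x} x≢0 y = begin
    x ⁻¹ * (x * y) ≡⟨ x∙yz≈y∙xz (x ⁻¹) x y ⟩
    x * (x ⁻¹ * y) ≡⟨ *-assoc x (x ⁻¹) y ⟨
    x * x ⁻¹ * y   ≡⟨ cong (_* y) (⁻¹-inverseʳ x≢0) ⟩
    1# * y         ≡⟨ *-identityˡ y ⟩
    y              ∎

  ⁻¹-cancelʳ : ∀ {x} → x ≢ 0# → ∀ y → x * (x ⁻¹ * y) ≡ y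
  ⁻¹-cancelʳ {x} x≢0 y = trans (x∙yz≈y∙xz x (x ⁻¹) y) (⁻¹-cancelˡ x≢0 y)

  *-cancelˡ : ∀ {x y z} → x ≢ 0# → x * y ≡ x * z → y ≡ z
  *-cancelˡ {x} {y} {z} x≢0 xy≡xz = begin
    y              ≡⟨ ⁻¹-cancelˡ x≢0 y ⟨
    x ⁻¹ * (x * y) ≡⟨ cong (x ⁻¹ *_) xy≡xz ⟩
    x ⁻¹ * (x * z) ≡⟨ ⁻¹-cancelˡ x≢0 z ⟩
    z              ∎

  *-cancelʳ : ∀ {x y z} → x ≢ 0# → y * x ≡ z * x → y ≡ z
  *-cancelʳ {x} {y} {z} x≢0 yx≡zx =
    *-cancelˡ x≢0 (trans (*-comm x y) (trans yx≡zx (*-comm z x)))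

  *-nonzero : ∀ {x y} → x ≢ 0# → y ≢ 0# → x * y ≢ 0#
  *-nonzero {x} x≢0 y≢0 xy≡0 = y≢0 (*-cancelˡ x≢0 (trans xy≡0 (sym (zeroʳ x))))

  ⁻¹-nonzero : ∀ {x} → x ≢ 0# → x ⁻¹ ≢ 0#
  ⁻¹-nonzero {x} x≢0 x⁻¹≡0 = 1≢0 (begin
    1#       ≡⟨ ⁻¹-inverseʳ x≢0 ⟨
    x * x ⁻¹ ≡⟨ cong (x *_) x⁻¹≡0 ⟩
    x * 0#   ≡⟨ zeroʳ x ⟩
    0#       ∎)

  0⁻¹≡0 : 0# ⁻¹ ≡ 0#
  0⁻¹≡0 with 0# ≟ 0#
  ... | yes _ = refl
  ... | no 0≢0 = contradiction refl 0≢0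

  ⁻¹-involutive : ∀ x → x ⁻¹ ⁻¹ ≡ x
  ⁻¹-involutive x = by-cases (x ≟ 0#)
    where
    by-cases : Dec (x ≡ 0#) → x ⁻¹ ⁻¹ ≡ x
    by-cases (yes refl) = trans (cong _⁻¹ 0⁻¹≡0) 0⁻¹≡0
    by-cases (no x≢0) = *-cancelˡ (⁻¹-nonzero x≢0) (begin
      x ⁻¹ * x ⁻¹ ⁻¹ ≡⟨ ⁻¹-inverseʳ (⁻¹-nonzero x≢0) ⟩
      1#             ≡⟨ ⁻¹-inverseʳ x≢0 ⟨
      x * x ⁻¹       ≡⟨ *-comm x (x ⁻¹) ⟩
      x ⁻¹ * x       ∎)

  ⁻¹-injective : ∀ {x y} → x ⁻¹ ≡ y ⁻¹ → x ≡ y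
  ⁻¹-injective {x} {y} x⁻¹≡y⁻¹ = begin
    x       ≡⟨ ⁻¹-involutive x ⟨
    x ⁻¹ ⁻¹ ≡⟨ cong _⁻¹ x⁻¹≡y⁻¹ ⟩
    y ⁻¹ ⁻¹ ≡⟨ ⁻¹-involutive y ⟩
    y       ∎

  pow≡^ : ∀ x n → pow x n ≡ x ^ n
  pow≡^ x zero = refl
  pow≡^ x (suc n) = cong (x *_) (pow≡^ x n)

  pow-distrib-* : ∀ x y n → pow (x * y) n ≡ pow x n * pow y n
  pow-distrib-* x y n rewrite pow≡^ (x * y) n | pow≡^ x n | pow≡^ y n = ^-distrib-* x y n

  pow-assocʳ : ∀ x m n → pow (pow x m) n ≡ pow x (m ℕ.* n)
  pow-assocʳ x m n rewrite pow≡^ (pow x m) n | pow≡^ x m | pow≡^ x (m ℕ.* n) =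
    ^-assocʳ x m n

  pow-1# : ∀ n → pow 1# n ≡ 1#
  pow-1# zero = refl
  pow-1# (suc n) = trans (*-identityˡ (pow 1# n)) (pow-1# n)

  pow-0# : ∀ n .{{_ : NonZero n}} → pow 0# n ≡ 0#
  pow-0# (suc n) = zeroˡ (pow 0# n)

  pow-nonzero : ∀ {x} n → x ≢ 0# → pow x n ≢ 0#
  pow-nonzero zero x≢0 = 1≢0
  pow-nonzero (suc n) x≢0 = *-nonzero x≢0 (pow-nonzero n x≢0)

  pow≡0⇒≡0 : ∀ {x} n .{{_ : NonZero n}} → pow x n ≡ 0# → x ≡ 0#
  pow≡0⇒≡0 {x} n xⁿ≡0 with x ≟ 0#
  ... | yes x≡0 = x≡0
  ... | no x≢0 = contradiction xⁿ≡0 (pow-nonzero n x≢0)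

module Counting {q : ℕ} (F : FiniteField q) where
  open FiniteField F

  private
    to : Fin q → Carrier
    to = Inverse.to enum

    from : Carrier → Fin q
    from = Inverse.from enum

    to-from : ∀ x → to (from x) ≡ x
    to-from = Inverse.strictlyInverseˡ enum

    to-injective : ∀ {i j} → to i ≡ to j → i ≡ j
    to-injective = Injection.injective (↔⇒↣ enum)

  elements : List Carrier
  elements = map to (allFin q)

  ∈-elements : ∀ x → x ∈ elements
  ∈-elements x = subst (_∈ elements) (to-from x) (∈-map⁺ to (∈-allFin (from x)))

  elements-unique : Unique elements
  elements-unique = Unique.map⁺ to-injective (Unique.allFin⁺ q)

  length-elements : length elements ≡ q
  length-elements = trans (length-map to (allFin q)) (length-tabulate {n = q} (λ i → i))

  module _ {P : Pred Carrier 0ℓ} (P? : Decidable P) where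

    satisfying : List Carrier
    satisfying = map to (filter (P? ∘ to) (allFin q))

    ∈-satisfying⁺ : ∀ {x} → P x → x ∈ satisfying
    ∈-satisfying⁺ {x} Px = ∈-map∘filter⁺ to (P? ∘ to)
      (from x , ∈-allFin (from x) , sym (to-from x) , subst P (sym (to-from x)) Px)

    ∈-satisfying⁻ : ∀ {x} → x ∈ satisfying → P x
    ∈-satisfying⁻ x∈ with ∈-map∘filter⁻ to (P? ∘ to) {xs = allFin q} x∈
    ... | _ , _ , refl , Px = Px

    satisfying-unique : Unique satisfying
    satisfying-unique = Unique.map⁺ to-injective (Unique.filter⁺ (P? ∘ to) (Unique.allFin⁺ q))

    length-satisfying : length satisfying ≡ count P P?
    length-satisfying = length-map to (filter (P? ∘ to) (allFin q))

    count-≥ : ∀ {xs} → Unique xs → All P xs → length xs ≤ count P P?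
    count-≥ xs! Pxs = subst (_ ≤_) length-satisfying
      (Unique-length-≤ _≟_ xs! (λ x∈xs → ∈-satisfying⁺ (All.lookup Pxs x∈xs)))

    count-≤ : ∀ {xs} → (∀ {x} → P x → x ∈ xs) → count P P? ≤ length xs
    count-≤ P⊆xs = subst (_≤ _) length-satisfying
      (Unique-length-≤ _≟_ satisfying-unique (P⊆xs ∘ ∈-satisfying⁻))

  1≤δ : ∀ g a x → 1 ≤ δ g a (g (x + a) - g x)
  1≤δ g a x = count-≥ (λ y → (g (y + a) - g y) ≟ (g (x + a) - g x)) ([] ∷ []) (refl ∷ [])

  almostKTo1-intro : ∀ {k f x₀} → k ≢ 1 → preimages f (f x₀) ≡ 1 →
                     (∀ {x} → x ≢ x₀ → preimages f (f x) ≡ k) → AlmostKTo1 k f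
  almostKTo1-intro {k} {f} {x₀} k≢1 fibre₀ fibre =
    f x₀ , (x₀ , refl) , fibre₀ , only-f₀ , others
    where
    only-f₀ : ∀ y → InImage f y → preimages f y ≡ 1 → y ≡ f x₀
    only-f₀ _ (x , refl) fibre≡1 with x ≟ x₀
    ... | yes refl = refl
    ... | no x≢x₀ = contradiction (trans (sym (fibre x≢x₀)) fibre≡1) k≢1

    others : ∀ y → InImage f y → y ≢ f x₀ → preimages f y ≡ k
    others _ (x , refl) fx≢fx₀ = fibre (fx≢fx₀ ∘ cong f)

module MonicPolynomials {q : ℕ} (F : FiniteField q) where
  open FiniteField F
  open FieldArithmetic F
  open HornerIdentities F
  open ≡-Reasoning

  -- c₀ ∷ c₁ ∷ … ∷ cₙ₋₁ stands for the monic polynomial xⁿ + cₙ₋₁xⁿ⁻¹ + … + c₁x + c₀.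
  evalMonic : ∀ {n} → Vec Carrier n → Carrier → Carrier
  evalMonic [] x = 1#
  evalMonic (c ∷ cs) x = x * evalMonic cs x + c

  deflate : ∀ {n} → Vec Carrier (suc n) → Carrier → Vec Carrier n
  deflate (c ∷ []) r = []
  deflate (c ∷ c′ ∷ cs) r = evalMonic (c′ ∷ cs) r ∷ deflate (c′ ∷ cs) r

  evalMonic-deflate-shifted : ∀ {n} (p : Vec Carrier (suc n)) y r →
    evalMonic p (y + r) ≡ y * evalMonic (deflate p r) (y + r) + evalMonic p r
  evalMonic-deflate-shifted (c ∷ []) y r = horner-base y r 1# c
  evalMonic-deflate-shifted (c ∷ c′ ∷ cs) y r = begin
    (y + r) * evalMonic (c′ ∷ cs) (y + r) + c
      ≡⟨ cong (λ e → (y + r) * e + c) (evalMonic-deflate-shifted (c′ ∷ cs) y r) ⟩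
    (y + r) * (y * evalMonic (deflate (c′ ∷ cs) r) (y + r) + evalMonic (c′ ∷ cs) r) + c
      ≡⟨ horner-step y r _ _ c ⟩
    y * evalMonic (deflate (c ∷ c′ ∷ cs) r) (y + r) + evalMonic (c ∷ c′ ∷ cs) r ∎

  evalMonic-deflate : ∀ {n} (p : Vec Carrier (suc n)) r s →
                      evalMonic p s ≡ (s - r) * evalMonic (deflate p r) s + evalMonic p r
  evalMonic-deflate p r s =
    subst (λ x → evalMonic p x ≡ (s - r) * evalMonic (deflate p r) x + evalMonic p r)
          (x-y+y≡x s r) (evalMonic-deflate-shifted p (s - r) r)

  deflate-root : ∀ {n} (p : Vec Carrier (suc n)) {r s} → evalMonic p r ≡ 0# → r ≢ s →
                 evalMonic p s ≡ 0# → evalMonic (deflate p r) s ≡ 0#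
  deflate-root p {r} {s} pr≡0 r≢s ps≡0 = *-cancelˡ s-r≢0 (begin
    (s - r) * q′             ≡⟨ +-identityʳ _ ⟨
    (s - r) * q′ + 0#        ≡⟨ cong ((s - r) * q′ +_) pr≡0 ⟨
    (s - r) * q′ + evalMonic p r ≡⟨ evalMonic-deflate p r s ⟨
    evalMonic p s            ≡⟨ ps≡0 ⟩
    0#                       ≡⟨ zeroʳ (s - r) ⟨
    (s - r) * 0#             ∎)
    where
    q′ = evalMonic (deflate p r) s

    s-r≢0 : s - r ≢ 0#
    s-r≢0 = r≢s ∘ sym ∘ x-y≡0⇒x≡y

  monic-roots≤degree : ∀ {n} (p : Vec Carrier n) {rs} → Unique rs →
                       All (λ r → evalMonic p r ≡ 0#) rs → length rs ≤ n
  monic-roots≤degree p {[]} _ _ = z≤n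
  monic-roots≤degree [] {r ∷ rs} _ (1≡0 ∷ _) = contradiction 1≡0 1≢0
  monic-roots≤degree p@(_ ∷ _) {r ∷ rs} (r∉rs ∷ rs!) (pr≡0 ∷ prs≡0) =
    s≤s (monic-roots≤degree (deflate p r) rs!
          (All.zipWith (λ (r≢s , ps≡0) → deflate-root p pr≡0 r≢s ps≡0) (r∉rs , prs≡0)))

  evalMonic-replicate-0# : ∀ n x → evalMonic (replicate n 0#) x ≡ pow x n
  evalMonic-replicate-0# zero x = refl
  evalMonic-replicate-0# (suc n) x =
    trans (+-identityʳ _) (cong (x *_) (evalMonic-replicate-0# n x))

module Fermat {q : ℕ} (F : FiniteField q) where
  open FiniteField F
  open FieldArithmetic F
  open Counting F
  open CommutativeSemigroupProperties *-commutativeSemigroup using (interchange)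
  open ≡-Reasoning

  ≢0? : Decidable (_≢ 0#)
  ≢0? x = ¬? (x ≟ 0#)

  nonzero : List Carrier
  nonzero = satisfying ≢0?

  1+length-nonzero : suc (length nonzero) ≡ q
  1+length-nonzero = subst (λ n → suc (length nonzero) ≡ n) length-elements (ℕₚ.≤-antisym
    (Unique-length-≤ _≟_ (All.tabulate 0≢nonzero ∷ satisfying-unique ≢0?) (λ {x} _ → ∈-elements x))
    (Unique-length-≤ _≟_ elements-unique (λ {x} _ → 0-or-nonzero x)))
    where
    0≢nonzero : ∀ {x} → x ∈ nonzero → 0# ≢ x
    0≢nonzero x∈ 0≡x = ∈-satisfying⁻ ≢0? x∈ (sym 0≡x)

    0-or-nonzero : ∀ x → x ∈ 0# ∷ nonzero
    0-or-nonzero x with x ≟ 0#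
    ... | yes x≡0 = here x≡0
    ... | no x≢0 = there (∈-satisfying⁺ ≢0? x≢0)

  length-nonzero : length nonzero ≡ q ∸ 1
  length-nonzero = cong (_∸ 1) 1+length-nonzero

  1≤q∸1 : 1 ≤ q ∸ 1
  1≤q∸1 = subst (1 ≤_) length-nonzero
    (Unique-length-≤ _≟_ ([] ∷ []) (λ { (here refl) → ∈-satisfying⁺ ≢0? 1≢0 }))

  product : List Carrier → Carrier
  product = foldr _*_ 1#

  product-↭ : ∀ {xs ys} → xs ↭ ys → product xs ≡ product ys
  product-↭ = Permutation.foldr-commMonoid (setoid Carrier) *-isCommutativeMonoid ∘ ↭⇒↭ₛ

  product-map-* : ∀ a xs → product (map (a *_) xs) ≡ pow a (length xs) * product xs
  product-map-* a [] = sym (*-identityˡ 1#)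
  product-map-* a (x ∷ xs) = begin
    a * x * product (map (a *_) xs)          ≡⟨ cong (a * x *_) (product-map-* a xs) ⟩
    a * x * (pow a (length xs) * product xs) ≡⟨ interchange a x _ (product xs) ⟩
    a * pow a (length xs) * (x * product xs) ∎

  product-nonzero : ∀ {xs} → All (_≢ 0#) xs → product xs ≢ 0#
  product-nonzero [] = 1≢0
  product-nonzero (x≢0 ∷ xs≢0) = *-nonzero x≢0 (product-nonzero xs≢0)

  -- Multiplication by a ≠ 0 permutes the nonzero elements, so a ^ (q - 1) * ∏ = ∏.
  fermat : ∀ {a} → a ≢ 0# → pow a (q ∸ 1) ≡ 1#
  fermat {a} a≢0 = subst (λ n → pow a n ≡ 1#) length-nonzero (*-cancelʳ ∏≢0 (begin
    pow a (length nonzero) * ∏   ≡⟨ product-map-* a nonzero ⟨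
    product (map (a *_) nonzero) ≡⟨ product-↭ a·nonzero↭nonzero ⟩
    ∏                            ≡⟨ *-identityˡ ∏ ⟨
    1# * ∏                       ∎))
    where
    ∏ : Carrier
    ∏ = product nonzero

    ∏≢0 : ∏ ≢ 0#
    ∏≢0 = product-nonzero (All.tabulate (∈-satisfying⁻ ≢0?))

    a·nonzero⊆nonzero : map (a *_) nonzero ⊆ nonzero
    a·nonzero⊆nonzero x∈ with ∈-map⁻ (a *_) x∈
    ... | y , y∈ , refl = ∈-satisfying⁺ ≢0? (*-nonzero a≢0 (∈-satisfying⁻ ≢0? y∈))

    nonzero⊆a·nonzero : nonzero ⊆ map (a *_) nonzero
    nonzero⊆a·nonzero {x} x∈ = subst (_∈ map (a *_) nonzero) (⁻¹-cancelʳ a≢0 x)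
      (∈-map⁺ (a *_) (∈-satisfying⁺ ≢0? (*-nonzero (⁻¹-nonzero a≢0) (∈-satisfying⁻ ≢0? x∈))))

    a·nonzero↭nonzero : map (a *_) nonzero ↭ nonzero
    a·nonzero↭nonzero = ∼bag⇒↭ (unique∧set⇒bag
      (Unique.map⁺ (*-cancelˡ a≢0) (satisfying-unique ≢0?)) (satisfying-unique ≢0?)
      (mk⇔ a·nonzero⊆nonzero nonzero⊆a·nonzero))

module RootsOfUnity {q : ℕ} (F : FiniteField q) where
  open FiniteField F
  open FieldArithmetic F
  open Counting F
  open MonicPolynomials F
  open Fermat F
  open CommutativeSemigroupProperties *-commutativeSemigroup using (x∙yz≈y∙xz)

  μ? : ∀ n → Decidable (λ x → pow x n ≡ 1#)
  μ? n x = pow x n ≟ 1#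

  μ : ℕ → List Carrier
  μ n = satisfying (μ? n)

  ∣μ∣≤ : ∀ n → length (μ (suc n)) ≤ suc n
  ∣μ∣≤ n = monic-roots≤degree (- 1# ∷ replicate n 0#) (satisfying-unique (μ? (suc n)))
    (All.tabulate (λ {x} x∈μ → trans (cong (λ e → (x * e) - 1#) (evalMonic-replicate-0# n x))
                                      (x≡y⇒x-y≡0 (∈-satisfying⁻ (μ? (suc n)) x∈μ))))

  pow-*-μ : ∀ k u {ζ} → pow ζ k ≡ 1# → pow (u * ζ) k ≡ pow u k
  pow-*-μ k u {ζ} ζᵏ≡1 = begin
    pow (u * ζ) k     ≡⟨ pow-distrib-* u ζ k ⟩
    pow u k * pow ζ k ≡⟨ cong (pow u k *_) ζᵏ≡1 ⟩
    pow u k * 1#      ≡⟨ *-identityʳ (pow u k) ⟩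
    pow u k           ∎
    where open ≡-Reasoning

  pow≡⇒∈-*μ : ∀ k {u x} → u ≢ 0# → pow x k ≡ pow u k → x ∈ map (u *_) (μ k)
  pow≡⇒∈-*μ k {u} {x} u≢0 xᵏ≡uᵏ = subst (_∈ map (u *_) (μ k)) (⁻¹-cancelʳ u≢0 x)
    (∈-map⁺ (u *_) (∈-satisfying⁺ (μ? k) x/u∈μk))
    where
    open ≡-Reasoning

    x/u∈μk : pow (u ⁻¹ * x) k ≡ 1#
    x/u∈μk = begin
      pow (u ⁻¹ * x) k       ≡⟨ pow-distrib-* (u ⁻¹) x k ⟩
      pow (u ⁻¹) k * pow x k ≡⟨ cong (pow (u ⁻¹) k *_) xᵏ≡uᵏ ⟩
      pow (u ⁻¹) k * pow u k ≡⟨ pow-distrib-* (u ⁻¹) u k ⟨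
      pow (u ⁻¹ * u) k       ≡⟨ cong (λ z → pow z k) (*-comm (u ⁻¹) u) ⟩
      pow (u * u ⁻¹) k       ≡⟨ cong (λ z → pow z k) (⁻¹-inverseʳ u≢0) ⟩
      pow 1# k               ≡⟨ pow-1# k ⟩
      1#                     ∎

  root : ℕ → Carrier → Carrier
  root k c with any? (λ y → pow y k ≟ c) elements
  ... | yes ∃root = proj₁ (satisfied ∃root)
  ... | no _ = 0#

  root-pow : ∀ k x → pow (root k (pow x k)) k ≡ pow x k
  root-pow k x with any? (λ y → pow y k ≟ pow x k) elements
  ... | yes ∃root = proj₂ (satisfied ∃root)
  ... | no ∄root = contradiction (Any.map (cong (λ z → pow z k) ∘ sym) (∈-elements x)) ∄root

  root-nonzero : ∀ k .{{_ : NonZero k}} {x} → x ≢ 0# → root k (pow x k) ≢ 0#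
  root-nonzero k {x} x≢0 ρ≡0 = pow-nonzero k x≢0 (begin
    pow x k                  ≡⟨ root-pow k x ⟨
    pow (root k (pow x k)) k ≡⟨ cong (λ z → pow z k) ρ≡0 ⟩
    pow 0# k                 ≡⟨ pow-0# k ⟩
    0#                       ∎)
    where open ≡-Reasoning

  -- What makes powPhase injective is that ρ = root k (x ^ k) depends on x ^ k only.
  powPhase : ℕ → Carrier → Carrier × Carrier
  powPhase k x = pow x k , x * root k (pow x k) ⁻¹

  powPhase-injective : ∀ k .{{_ : NonZero k}} {x y} → powPhase k x ≡ powPhase k y → x ≡ y
  powPhase-injective k {x} {y} eq with x ≟ 0#
  ... | yes refl = sym (pow≡0⇒≡0 k (trans (sym xᵏ≡yᵏ) (pow-0# k)))
    where xᵏ≡yᵏ = cong proj₁ eq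
  ... | no x≢0 = *-cancelʳ (⁻¹-nonzero (root-nonzero k x≢0))
    (trans (cong proj₂ eq) (cong (λ c → y * root k c ⁻¹) (sym (cong proj₁ eq))))

  powPhase-∈ : ∀ k .{{_ : NonZero k}} {t x} → q ∸ 1 ≡ t ℕ.* k → x ≢ 0# →
               powPhase k x ∈ cartesianProduct (μ t) (μ k)
  powPhase-∈ k {t} {x} q-1≡t*k x≢0 =
    ∈-cartesianProduct⁺ (∈-satisfying⁺ (μ? t) xᵏ∈μt) (∈-satisfying⁺ (μ? k) x/ρ∈μk)
    where
    open ≡-Reasoning
    ρ = root k (pow x k)

    xᵏ∈μt : pow (pow x k) t ≡ 1#
    xᵏ∈μt = begin
      pow (pow x k) t ≡⟨ pow-assocʳ x k t ⟩
      pow x (k ℕ.* t) ≡⟨ cong (pow x) (trans (ℕₚ.*-comm k t) (sym q-1≡t*k)) ⟩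
      pow x (q ∸ 1)   ≡⟨ fermat x≢0 ⟩
      1#              ∎

    x/ρ∈μk : pow (x * ρ ⁻¹) k ≡ 1#
    x/ρ∈μk = begin
      pow (x * ρ ⁻¹) k       ≡⟨ pow-distrib-* x (ρ ⁻¹) k ⟩
      pow x k * pow (ρ ⁻¹) k ≡⟨ cong (_* pow (ρ ⁻¹) k) (root-pow k x) ⟨
      pow ρ k * pow (ρ ⁻¹) k ≡⟨ pow-distrib-* ρ (ρ ⁻¹) k ⟨
      pow (ρ * ρ ⁻¹) k       ≡⟨ cong (λ z → pow z k) (⁻¹-inverseʳ (root-nonzero k x≢0)) ⟩
      pow 1# k               ≡⟨ pow-1# k ⟩
      1#                     ∎

  ∣μ∣≥ : ∀ n → suc n ∣ q ∸ 1 → suc n ≤ length (μ (suc n))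
  ∣μ∣≥ n (divides zero q-1≡0) = contradiction (subst (1 ≤_) q-1≡0 1≤q∸1) λ ()
  ∣μ∣≥ n (divides t@(suc t′) q-1≡t*k) = ℕₚ.*-cancelˡ-≤ t (begin
    t ℕ.* k                               ≡⟨ trans (sym q-1≡t*k) (sym length-nonzero) ⟩
    length nonzero                        ≡⟨ length-map (powPhase k) nonzero ⟨
    length (map (powPhase k) nonzero)     ≤⟨ Unique-length-≤ (≡-dec _≟_ _≟_) image-unique image⊆ ⟩
    length (cartesianProduct (μ t) (μ k)) ≡⟨ length-cartesianProduct (μ t) (μ k) ⟩
    length (μ t) ℕ.* length (μ k)         ≤⟨ ℕₚ.*-monoˡ-≤ (length (μ k)) (∣μ∣≤ t′) ⟩
    t ℕ.* length (μ k)                    ∎)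
    where
    open ℕₚ.≤-Reasoning
    k = suc n

    image-unique : Unique (map (powPhase k) nonzero)
    image-unique = Unique.map⁺ (powPhase-injective k) (satisfying-unique ≢0?)

    image⊆ : map (powPhase k) nonzero ⊆ cartesianProduct (μ t) (μ k)
    image⊆ z∈ with ∈-map⁻ (powPhase k) {xs = nonzero} z∈
    ... | x , x∈ , refl = powPhase-∈ k {t} q-1≡t*k (∈-satisfying⁻ ≢0? x∈)

  shiftPoint : Carrier → Carrier → Carrier
  shiftPoint a ζ = a * (ζ - 1#) ⁻¹

  shiftPoint-spec : ∀ a {ζ} → ζ ≢ 1# → ζ * shiftPoint a ζ ≡ shiftPoint a ζ + a
  shiftPoint-spec a {ζ} ζ≢1 = begin
    ζ * x                        ≡⟨ cong (_* x) (x-y+y≡x ζ 1#) ⟨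
    (w + 1#) * x                 ≡⟨ distribʳ x w 1# ⟩
    w * (a * w ⁻¹) + 1# * x      ≡⟨ cong₂ _+_ (x∙yz≈y∙xz w a (w ⁻¹)) (*-identityˡ x) ⟩
    a * (w * w ⁻¹) + x           ≡⟨ cong (λ z → a * z + x) (⁻¹-inverseʳ (ζ≢1 ∘ x-y≡0⇒x≡y)) ⟩
    a * 1# + x                   ≡⟨ cong (_+ x) (*-identityʳ a) ⟩
    a + x                        ≡⟨ +-comm a x ⟩
    x + a                        ∎
    where
    open ≡-Reasoning
    w = ζ - 1#
    x = shiftPoint a ζ

  shiftPoint-injective : ∀ {a} → a ≢ 0# → ∀ {ζ ζ′} → shiftPoint a ζ ≡ shiftPoint a ζ′ → ζ ≡ ζ′
  shiftPoint-injective a≢0 {ζ} {ζ′} eq = begin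
    ζ            ≡⟨ x-y+y≡x ζ 1# ⟨
    ζ - 1# + 1#  ≡⟨ cong (_+ 1#) (⁻¹-injective (*-cancelˡ a≢0 eq)) ⟩
    ζ′ - 1# + 1# ≡⟨ x-y+y≡x ζ′ 1# ⟩
    ζ′           ∎
    where open ≡-Reasoning

  pow-shiftPoint : ∀ k a {ζ} → pow ζ k ≡ 1# → ζ ≢ 1# →
                   pow (shiftPoint a ζ + a) k ≡ pow (shiftPoint a ζ) k
  pow-shiftPoint k a {ζ} ζᵏ≡1 ζ≢1 = begin
    pow (shiftPoint a ζ + a) k ≡⟨ cong (λ z → pow z k) (shiftPoint-spec a ζ≢1) ⟨
    pow (ζ * shiftPoint a ζ) k ≡⟨ cong (λ z → pow z k) (*-comm ζ (shiftPoint a ζ)) ⟩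
    pow (shiftPoint a ζ * ζ) k ≡⟨ pow-*-μ k (shiftPoint a ζ) ζᵏ≡1 ⟩
    pow (shiftPoint a ζ) k     ∎
    where open ≡-Reasoning

module DivisibleMaps {q : ℕ} (F : FiniteField q) (k : ℕ)
                     (f f′ : FiniteField.Carrier F → FiniteField.Carrier F)
                     (f≡f′∘pow : ∀ x → f x ≡ f′ (FiniteField.pow F x k)) where
  open FiniteField F
  open FieldArithmetic F
  open Counting F
  open RootsOfUnity F
  open ≡-Reasoning

  pow≡⇒f≡ : ∀ {x y} → pow x k ≡ pow y k → f x ≡ f y
  pow≡⇒f≡ {x} {y} xᵏ≡yᵏ = begin
    f x          ≡⟨ f≡f′∘pow x ⟩
    f′ (pow x k) ≡⟨ cong f′ xᵏ≡yᵏ ⟩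
    f′ (pow y k) ≡⟨ f≡f′∘pow y ⟨
    f y          ∎

  ∣μ∣≤δ : ∀ {a v} → a ≢ 0# → f (v + a) ≡ f v → pow (v + a) k ≢ pow v k →
          length (μ k) ≤ δ f a 0#
  ∣μ∣≤δ {a} {v} a≢0 f[v+a]≡fv [v+a]ᵏ≢vᵏ = ℕₚ.≤-trans ∣μ∣≤1+∣μ∖1∣
    (subst (_≤ δ f a 0#) (cong suc (length-map (shiftPoint a) μ∖1))
      (count-≥ (λ x → (f (x + a) - f x) ≟ 0#) zeros-unique zeros-vanish))
    where
    ≢1? : Decidable (_≢ 1#)
    ≢1? ζ = ¬? (ζ ≟ 1#)

    μ∖1 : List Carrier
    μ∖1 = filter ≢1? (μ k)

    ∣μ∣≤1+∣μ∖1∣ : length (μ k) ≤ suc (length μ∖1)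
    ∣μ∣≤1+∣μ∖1∣ = Unique-length-≤ _≟_ (satisfying-unique (μ? k)) 1-or-μ∖1
      where
      1-or-μ∖1 : μ k ⊆ 1# ∷ μ∖1
      1-or-μ∖1 {ζ} ζ∈μ with ζ ≟ 1#
      ... | yes ζ≡1 = here ζ≡1
      ... | no ζ≢1 = there (∈-filter⁺ ≢1? ζ∈μ ζ≢1)

    shift-pow : ∀ {ζ} → ζ ∈ μ∖1 → pow (shiftPoint a ζ + a) k ≡ pow (shiftPoint a ζ) k
    shift-pow ζ∈ with ∈-filter⁻ ≢1? {xs = μ k} ζ∈
    ... | ζ∈μ , ζ≢1 = pow-shiftPoint k a (∈-satisfying⁻ (μ? k) ζ∈μ) ζ≢1

    v∉shifts : All (v ≢_) (map (shiftPoint a) μ∖1)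
    v∉shifts = AllP.map⁺ (All.tabulate (λ ζ∈ v≡x → [v+a]ᵏ≢vᵏ
      (subst (λ x → pow (x + a) k ≡ pow x k) (sym v≡x) (shift-pow ζ∈))))

    zeros-unique : Unique (v ∷ map (shiftPoint a) μ∖1)
    zeros-unique = v∉shifts ∷ Unique.map⁺ (shiftPoint-injective a≢0)
                                           (Unique.filter⁺ ≢1? (satisfying-unique (μ? k)))

    zeros-vanish : All (λ x → f (x + a) - f x ≡ 0#) (v ∷ map (shiftPoint a) μ∖1)
    zeros-vanish = x≡y⇒x-y≡0 f[v+a]≡fv
               ∷ AllP.map⁺ (All.tabulate (λ ζ∈ → x≡y⇒x-y≡0 (pow≡⇒f≡ (shift-pow ζ∈))))

  module _ (δ<∣μ∣ : ∀ a → a ≢ 0# → δ f a 0# < length (μ k)) where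

    f≡⇒pow≡ : ∀ {u v} → f u ≡ f v → pow u k ≡ pow v k
    f≡⇒pow≡ {u} {v} fu≡fv with pow u k ≟ pow v k
    ... | yes uᵏ≡vᵏ = uᵏ≡vᵏ
    ... | no uᵏ≢vᵏ = contradiction (∣μ∣≤δ a≢0 f[v+a]≡fv [v+a]ᵏ≢vᵏ) (ℕₚ.<⇒≱ (δ<∣μ∣ a a≢0))
      where
      a = u - v

      v+a≡u : v + a ≡ u
      v+a≡u = trans (+-comm v a) (x-y+y≡x u v)

      a≢0 : a ≢ 0#
      a≢0 = uᵏ≢vᵏ ∘ cong (λ x → pow x k) ∘ x-y≡0⇒x≡y

      f[v+a]≡fv : f (v + a) ≡ f v
      f[v+a]≡fv = subst (λ x → f x ≡ f v) (sym v+a≡u) fu≡fv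

      [v+a]ᵏ≢vᵏ : pow (v + a) k ≢ pow v k
      [v+a]ᵏ≢vᵏ = subst (λ x → pow x k ≢ pow v k) (sym v+a≡u) uᵏ≢vᵏ

    preimages-f0 : .{{_ : NonZero k}} → preimages f (f 0#) ≡ 1
    preimages-f0 = ℕₚ.≤-antisym
      (count-≤ (λ x → f x ≟ f 0#) {xs = [ 0# ]} (here ∘ fx≡f0⇒x≡0))
      (count-≥ (λ x → f x ≟ f 0#) ([] ∷ []) (refl ∷ []))
      where
      fx≡f0⇒x≡0 : ∀ {x} → f x ≡ f 0# → x ≡ 0#
      fx≡f0⇒x≡0 fx≡f0 = pow≡0⇒≡0 k (trans (f≡⇒pow≡ fx≡f0) (pow-0# k))

    preimages-fu : ∀ {u} → u ≢ 0# → preimages f (f u) ≡ length (μ k)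
    preimages-fu {u} u≢0 = subst (λ n → preimages f (f u) ≡ n) (length-map (u *_) (μ k))
      (ℕₚ.≤-antisym (count-≤ P? (pow≡⇒∈-*μ k u≢0 ∘ f≡⇒pow≡))
                    (count-≥ P? (Unique.map⁺ (*-cancelˡ u≢0) (satisfying-unique (μ? k)))
                                (AllP.map⁺ (All.tabulate (pow≡⇒f≡ ∘ pow-*-μ k u ∘ ∈-μ)))))
      where
      P? : Decidable (λ x → f x ≡ f u)
      P? x = f x ≟ f u

      ∈-μ : ∀ {ζ} → ζ ∈ μ k → pow ζ k ≡ 1#
      ∈-μ = ∈-satisfying⁻ (μ? k)

theorem3p2 : (q : ℕ) → IsPrimePower q → (F : FiniteField q) → (d : ℕ) →
    suc d ∣ q ∸ 1 → (f : FiniteField.Carrier F → FiniteField.Carrier F) →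
    FiniteField.Divisible F (suc d) f → FiniteField.DiffUniform F d f →
    FiniteField.AlmostKTo1 F (suc d) f
theorem3p2 q _ F d k∣q-1 f (f′ , f≡f′∘pow) (δ≤d , _) =
  almostKTo1-intro k≢1 (preimages-f0 δ<∣μ∣) (λ x≢0 → trans (preimages-fu δ<∣μ∣ x≢0) ∣μ∣≡k)
  where
  open FiniteField F
  open Counting F
  open RootsOfUnity F
  open DivisibleMaps F (suc d) f f′ f≡f′∘pow

  ∣μ∣≡k : length (μ (suc d)) ≡ suc d
  ∣μ∣≡k = ℕₚ.≤-antisym (∣μ∣≤ d) (∣μ∣≥ d k∣q-1)

  δ<∣μ∣ : ∀ a → a ≢ 0# → δ f a 0# < length (μ (suc d))
  δ<∣μ∣ a a≢0 = subst (δ f a 0# <_) (sym ∣μ∣≡k) (s≤s (δ≤d a 0# a≢0))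

  1≤d : 1 ≤ d
  1≤d = ℕₚ.≤-trans (1≤δ f 1# 0#) (δ≤d 1# _ 1≢0)

  k≢1 : suc d ≢ 1
  k≢1 = ℕₚ.<⇒≢ (s≤s 1≤d) ∘ sym
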